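{- Let $S\subset\mathbb{Z}^2$ be realizable and let $(\widehat{G},\widehat{W})$ be its canonical realization, with $\widehat{W}=\{\omega_1,\omega_2\}$. Suppose $x\in S$ and there is a shortest path in $\widehat{G}$ between $\omega_1$ and $x$ passing through an edge $uv$. Suppose that for some integers $\alpha,\beta$ at least one of the following holds: (i) $u=(\alpha,\beta+1)$, $v=(\alpha+1,\beta)$, $t=(\alpha,\beta)\in S$; (ii) $u=(\alpha,\beta+1)$, $v=(\alpha+1,\beta+1)$, $t=(\alpha,\beta)\in S$; (iii) $u=(\alpha,\beta+2)$, $v=(\alpha+1,\beta+1)$, $t=(\alpha,\beta)\in S$; (iv) $u=(\alpha,\beta)$, $v=(\alpha+1,\beta+1)$, $t=(\alpha,\beta+2)\in S$. Then $\omega_1\ne u$ and there exists a shortest path in $\widehat{G}$ between $\omega_1$ and $x$ avoiding the edge $uv$. Moreover, in such a case the graph $\widehat{G}-uv$ is connected.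
   Context: A finite set $S\subset\mathbb{Z}^2$ is realizable if there are a finite simple connected graph $G$ and an ordered vertex set $W=(\omega_1,\omega_2)$ such that the map $u\mapsto (d(u,\omega_1),d(u,\omega_2))$ ($d$ the shortest-path distance) is injective on $V(G)$ with image $S$. For realizable $S$, the canonical realization $(\widehat{G},\widehat{W})$ is: $V(\widehat{G})=S$; $x,y\in S$ adjacent iff $\max(\vert x_1-y_1\vert,\vert x_2-y_2\vert)=1$; $\omega_i$ is the unique element of $S$ with $i$-th coordinate $0$, and $\widehat{W}=\{\omega_1,\omega_2\}$. In this realization, $d_{\widehat{G}}(x,\omega_i)=x_i$ for all $x\in S$. -}

module Defs where

open import Data.Nat using (ℕ; zero; suc; _≤_; _⊔_)
open import Data.Integer using (ℤ; +_; _-_; ∣_∣) renaming (_+_ to _+ℤ_)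
open import Data.Fin using (Fin)
open import Data.Product using (Σ; ∃; _×_; _,_; proj₁; proj₂)
open import Data.Sum using (_⊎_)
open import Data.List using (List)
open import Data.List.Membership.Propositional using (_∈_)
open import Relation.Binary.PropositionalEquality using (_≡_)
open import Relation.Nullary using (¬_)
open import Function.Definitions using (Injective)

Point : Set
Point = ℤ × ℤ

data Walk {V : Set} (E : V → V → Set) : V → V → ℕ → Set where
  []  : ∀ {x} → Walk E x x 0
  _∷_ : ∀ {x y z k} → E x y → Walk E y z k → Walk E x z (suc k)

Dist : {V : Set} (E : V → V → Set) → V → V → ℕ → Set
Dist E x y k = Walk E x y k × (∀ m → Walk E x y m → k ≤ m)

data UsesEdge {V : Set} {E : V → V → Set} (a b : V) : ∀ {x z k} → Walk E x z k → Set where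
  here  : ∀ {x y z k} (e : E x y) (w : Walk E y z k) →
          (x ≡ a × y ≡ b) ⊎ (x ≡ b × y ≡ a) → UsesEdge a b (e ∷ w)
  there : ∀ {x y z k} (e : E x y) {w : Walk E y z k} →
          UsesEdge a b w → UsesEdge a b (e ∷ w)

record SimpleGraph : Set₁ where
  field
    n     : ℕ
    Adj   : Fin n → Fin n → Set
    sym   : ∀ {a b} → Adj a b → Adj b a
    irrfl : ∀ {a} → ¬ Adj a a

pt : ℕ → ℕ → Point
pt a b = (+ a , + b)

Connected : SimpleGraph → Set
Connected G = ∀ a b → ∃ λ k → Walk (SimpleGraph.Adj G) a b k

Realizable : List Point → Set₁
Realizable S =
  Σ SimpleGraph λ G → let open SimpleGraph G in
  Connected G ×
  Σ (Fin n) λ ω₁ → Σ (Fin n) λ ω₂ →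
  Σ (Fin n → ℕ) λ d₁ → Σ (Fin n → ℕ) λ d₂ →
    (∀ u → Dist Adj u ω₁ (d₁ u)) ×
    (∀ u → Dist Adj u ω₂ (d₂ u)) ×
    Injective _≡_ _≡_ (λ u → pt (d₁ u) (d₂ u)) ×
    (∀ p → p ∈ S → ∃ λ u → pt (d₁ u) (d₂ u) ≡ p) ×
    (∀ u → pt (d₁ u) (d₂ u) ∈ S)

CAdj : List Point → Point → Point → Set
CAdj S x y = x ∈ S × y ∈ S ×
  ((∣ proj₁ x - proj₁ y ∣ ⊔ ∣ proj₂ x - proj₂ y ∣) ≡ 1)

data Config (u v t : Point) : Set where
  case-i   : ∀ α β → u ≡ (α , β +ℤ + 1) → v ≡ (α +ℤ + 1 , β) → t ≡ (α , β) → Config u v t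
  case-ii  : ∀ α β → u ≡ (α , β +ℤ + 1) → v ≡ (α +ℤ + 1 , β +ℤ + 1) → t ≡ (α , β) → Config u v t
  case-iii : ∀ α β → u ≡ (α , β +ℤ + 2) → v ≡ (α +ℤ + 1 , β +ℤ + 1) → t ≡ (α , β) → Config u v t
  case-iv  : ∀ α β → u ≡ (α , β) → v ≡ (α +ℤ + 1 , β +ℤ + 1) → t ≡ (α , β +ℤ + 2) → Config u v t

-- In the canonical realization the first coordinate is the distance to ω₁, and realizability
-- says that every vertex of S with first coordinate m + 1 has a neighbour with first coordinate
-- m, so every vertex is reached from ω₁ by a walk that never rises above its target. In each
-- configuration, t lies on the level a of u, is adjacent to v (on level a + 1) and differs from
-- u. A shortest path cannot cross uv downwards; when it crosses upwards, its part before u can be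
-- replaced by such a walk to t followed by the edge tv, and its part after v stays on levels
-- ≥ a + 1. The same two walks give the detours u ⇝ ω₁ ⇝ t → v that keep Ĝ − uv connected.
module Submission where

open import Defs
open import Data.Nat as ℕ using (ℕ; zero; suc; _≤_; _<_; _⊔_; z≤n; s≤s; s≤s⁻¹)
open import Data.Nat.Properties
  using (≤-antisym; ≤-refl; ≤-reflexive; ≤-trans; <-irrefl; +-suc; +-comm; +-identityʳ;
         +-cancelʳ-≤; +-monoˡ-≤; n≤1+n; m≤m⊔n; m≥n⇒m⊔n≡m; ∣-∣-comm; m≤∣m-n∣+n; ∣m-m+n∣≡n;
         1+n≰n; 1+n≢n; module ≤-Reasoning)
open import Data.Integer as ℤ using (+_; +[1+_]; -[1+_]; _⊖_; _-_; ∣_∣)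
open import Data.Integer.Properties using (m-n≡m⊖n; [1+m]⊖[1+n]≡m⊖n; ∣i-j∣≡∣j-i∣; +-0-abelianGroup)
  renaming (+-identityʳ to ℤ-+-identityʳ)
open import Data.Integer.Tactic.RingSolver using (solve-∀)
open import Algebra.Bundles using (AbelianGroup)
open import Algebra.Properties.Group (AbelianGroup.group +-0-abelianGroup) using (∙-cancelˡ)
open import Data.Fin using (Fin)
open import Data.Product using (Σ; ∃; _×_; _,_; proj₁; proj₂)
open import Data.Product.Properties using (≡-dec)
open import Data.Sum using (_⊎_; inj₁; inj₂)
open import Data.Empty using (⊥-elim)
open import Data.List using (List)
open import Data.List.Membership.Propositional using (_∈_)
open import Relation.Binary.Definitions using (DecidableEquality)
open import Relation.Binary.PropositionalEquality
  using (_≡_; _≢_; refl; sym; trans; cong; cong₂; subst; module ≡-Reasoning)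
open import Relation.Nullary using (¬_; yes; no)
open import Relation.Nullary.Decidable using (_×-dec_; _⊎-dec_)

Joins : {V : Set} → V → V → V → V → Set
Joins a b x y = (x ≡ a × y ≡ b) ⊎ (x ≡ b × y ≡ a)

module _ {V : Set} {E : V → V → Set} where

  infixr 5 _++_
  _++_ : ∀ {x y z m n} → Walk E x y m → Walk E y z n → Walk E x z (m ℕ.+ n)
  []      ++ w′ = w′
  (e ∷ w) ++ w′ = e ∷ (w ++ w′)

  _∷ʳ_ : ∀ {x y z m} → Walk E x y m → E y z → Walk E x z (suc m)
  []       ∷ʳ e = e ∷ []
  (e′ ∷ w) ∷ʳ e = e′ ∷ (w ∷ʳ e)

  reverse : (∀ {x y} → E x y → E y x) → ∀ {x y k} → Walk E x y k → Walk E y x k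
  reverse E-sym []      = []
  reverse E-sym (e ∷ w) = reverse E-sym w ∷ʳ E-sym e

  length-zero⇒≡ : ∀ {x y} → Walk E x y 0 → x ≡ y
  length-zero⇒≡ [] = refl

  data All (P : V → Set) : ∀ {x y k} → Walk E x y k → Set where
    [_] : ∀ {x} → P x → All P ([] {x = x})
    _∷_ : ∀ {x y z k} {e : E x y} {w : Walk E y z k} → P x → All P w → All P (e ∷ w)

  All-head : ∀ {P x y k} {w : Walk E x y k} → All P w → P x
  All-head [ p ]   = p
  All-head (p ∷ _) = p

  All-map : ∀ {P Q : V → Set} → (∀ {z} → P z → Q z) → ∀ {x y k} {w : Walk E x y k} → All P w → All Q w
  All-map f [ p ]    = [ f p ]
  All-map f (p ∷ ps) = f p ∷ All-map f ps

  All-∷ʳ : ∀ {P x y z m} {w : Walk E x y m} {e : E y z} → All P w → P z → All P (w ∷ʳ e)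
  All-∷ʳ [ p ]    pz = p ∷ [ pz ]
  All-∷ʳ (p ∷ ps) pz = p ∷ All-∷ʳ ps pz

  All-reverse : ∀ (E-sym : ∀ {x y} → E x y → E y x) {P x y k} {w : Walk E x y k} →
                All P w → All P (reverse E-sym w)
  All-reverse E-sym [ p ]    = [ p ]
  All-reverse E-sym (p ∷ ps) = All-∷ʳ (All-reverse E-sym ps) p

  Avoids : V → V → ∀ {x y k} → Walk E x y k → Set
  Avoids a b w = ¬ UsesEdge a b w

  AvoidingWalk : V → V → V → V → Set
  AvoidingWalk a b x y = ∃ λ m → Σ (Walk E x y m) (Avoids a b)

  UsesEdge⇒All : ∀ {P a b x y k} {w : Walk E x y k} → All P w → UsesEdge a b w → P a × P b
  UsesEdge⇒All (p ∷ ps) (here _ _ (inj₁ (refl , refl))) = p , All-head ps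
  UsesEdge⇒All (p ∷ ps) (here _ _ (inj₂ (refl , refl))) = All-head ps , p
  UsesEdge⇒All (_ ∷ ps) (there _ uses)                  = UsesEdge⇒All ps uses

  Avoids-∷ : ∀ {a b x y z k} {e : E x y} {w : Walk E y z k} →
             ¬ Joins a b x y → Avoids a b w → Avoids a b (e ∷ w)
  Avoids-∷ ¬joins _     (here _ _ joins) = ¬joins joins
  Avoids-∷ _      avoid (there _ uses)   = avoid uses

  Avoids-++ : ∀ {a b x y z m n} {w : Walk E x y m} {w′ : Walk E y z n} →
              Avoids a b w → Avoids a b w′ → Avoids a b (w ++ w′)
  Avoids-++ {w = []}    _     avoid′ uses                  = avoid′ uses
  Avoids-++ {w = e ∷ w} avoid _      (here _ _ joins)      = avoid (here e w joins)
  Avoids-++ {w = e ∷ w} avoid avoid′ (there _ uses)        = Avoids-++ (λ u → avoid (there e u)) avoid′ uses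

  data Crossing (a b : V) {x z k} (w : Walk E x z k) : Set where
    crossing : ∀ {p q i j} (w₁ : Walk E x p i) (e : E p q) (w₂ : Walk E q z j) →
               Joins a b p q → i ℕ.+ suc j ≡ k → Crossing a b w

  UsesEdge⇒Crossing : ∀ {a b x z k} {w : Walk E x z k} → UsesEdge a b w → Crossing a b w
  UsesEdge⇒Crossing (here e w joins) = crossing [] e w joins refl
  UsesEdge⇒Crossing (there e uses) with UsesEdge⇒Crossing uses
  ... | crossing w₁ e′ w₂ joins len = crossing (e ∷ w₁) e′ w₂ joins (cong suc len)

  reroute : DecidableEquality V → ∀ {a b} → AvoidingWalk a b a b → AvoidingWalk a b b a →
            ∀ {x y k} → Walk E x y k → AvoidingWalk a b x y
  reroute _≟_ {a} {b} (_ , ab , ab-avoids) (_ , ba , ba-avoids) = go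
    where
    go : ∀ {x y k} → Walk E x y k → AvoidingWalk a b x y
    go []                          = 0 , [] , λ ()
    go {x} (_∷_ {y = y} e w) with go w | (x ≟ a ×-dec y ≟ b) ⊎-dec (x ≟ b ×-dec y ≟ a)
    ... | _ , w′ , avoid | yes (inj₁ (refl , refl)) = _ , ab ++ w′ , Avoids-++ ab-avoids avoid
    ... | _ , w′ , avoid | yes (inj₂ (refl , refl)) = _ , ba ++ w′ , Avoids-++ ba-avoids avoid
    ... | _ , w′ , avoid | no ¬joins                = _ , e ∷ w′ , Avoids-∷ ¬joins avoid

∣m⊖n∣≡∣m-n∣ : ∀ m n → ∣ m ⊖ n ∣ ≡ ℕ.∣ m - n ∣
∣m⊖n∣≡∣m-n∣ zero    zero    = refl
∣m⊖n∣≡∣m-n∣ zero    (suc n) = refl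
∣m⊖n∣≡∣m-n∣ (suc m) zero    = refl
∣m⊖n∣≡∣m-n∣ (suc m) (suc n) = trans (cong ∣_∣ ([1+m]⊖[1+n]≡m⊖n m n)) (∣m⊖n∣≡∣m-n∣ m n)

∣+m-+n∣≡∣m-n∣ : ∀ m n → ∣ + m - + n ∣ ≡ ℕ.∣ m - n ∣
∣+m-+n∣≡∣m-n∣ m n = trans (cong ∣_∣ (m-n≡m⊖n m n)) (∣m⊖n∣≡∣m-n∣ m n)

∣m-n∣≤1 : ∀ {m n} → n ≤ suc m → m ≤ suc n → ℕ.∣ m - n ∣ ≤ 1
∣m-n∣≤1 {zero}        {zero}        _      _      = z≤n
∣m-n∣≤1 {zero}        {suc zero}    _      _      = s≤s z≤n
∣m-n∣≤1 {zero}        {suc (suc _)} (s≤s ()) _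
∣m-n∣≤1 {suc zero}    {zero}        _      _      = s≤s z≤n
∣m-n∣≤1 {suc (suc _)} {zero}        _      (s≤s ())
∣m-n∣≤1 {suc m}       {suc n}       n≤1+m  m≤1+n  = ∣m-n∣≤1 (s≤s⁻¹ n≤1+m) (s≤s⁻¹ m≤1+n)

∣m-n∣≤1⇒n≤1+m : ∀ {m n} → ℕ.∣ m - n ∣ ≤ 1 → n ≤ suc m
∣m-n∣≤1⇒n≤1+m {m} {n} d≤1 =
  ≤-trans (m≤∣m-n∣+n n m) (+-monoˡ-≤ m (subst (_≤ 1) (∣-∣-comm m n) d≤1))

adjacent-layers : ∀ {a b p q} → b ≡ suc a → q ≤ suc p → p ≤ suc q →
                  ∣ + a - + b ∣ ⊔ ∣ + p - + q ∣ ≡ 1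
adjacent-layers {a} {_} {p} {q} refl q≤1+p p≤1+q =
  trans (cong₂ _⊔_ (trans (∣+m-+n∣≡∣m-n∣ a (suc a)) ∣a-[1+a]∣≡1) (∣+m-+n∣≡∣m-n∣ p q))
        (m≥n⇒m⊔n≡m (∣m-n∣≤1 q≤1+p p≤1+q))
  where
  ∣a-[1+a]∣≡1 : ℕ.∣ a - suc a ∣ ≡ 1
  ∣a-[1+a]∣≡1 = subst (λ b → ℕ.∣ a - b ∣ ≡ 1) (+-comm a 1) (∣m-m+n∣≡n a 1)

i+[1+n]≢i : ∀ i n → i ℤ.+ +[1+ n ] ≢ i
i+[1+n]≢i i n eq with ∙-cancelˡ i +[1+ n ] (+ 0) (trans eq (sym (ℤ-+-identityʳ i)))
... | ()

∣i+1∣≡1+∣i∣ : ∀ i → i ≡ + ∣ i ∣ → ∣ i ℤ.+ + 1 ∣ ≡ suc ∣ i ∣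
∣i+1∣≡1+∣i∣ (+ n) _ = +-comm n 1

i-[i+1]≡-1 : ∀ i → i - (i ℤ.+ + 1) ≡ -[1+ 0 ]
i-[i+1]≡-1 = solve-∀

i-i≡0 : ∀ i → i - i ≡ + 0
i-i≡0 = solve-∀

[i+2]-[i+1]≡1 : ∀ i → (i ℤ.+ + 2) - (i ℤ.+ + 1) ≡ + 1
[i+2]-[i+1]≡1 = solve-∀

CAdj-sym : ∀ {S x y} → CAdj S x y → CAdj S y x
CAdj-sym {x = x} {y} (x∈S , y∈S , eq) = y∈S , x∈S ,
  trans (cong₂ _⊔_ (∣i-j∣≡∣j-i∣ (proj₁ y) (proj₁ x)) (∣i-j∣≡∣j-i∣ (proj₂ y) (proj₂ x))) eq

All-∈ : ∀ {S x y k} → x ∈ S → (w : Walk (CAdj S) x y k) → All (_∈ S) w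
All-∈ x∈S []      = [ x∈S ]
All-∈ x∈S (e ∷ w) = x∈S ∷ All-∈ (proj₁ (proj₂ e)) w

_≟ₚ_ : DecidableEquality Point
_≟ₚ_ = ≡-dec ℤ._≟_ ℤ._≟_

-- Only meaningful on S, where `nonnegative` below shows that no information is lost.
height : Point → ℕ
height z = ∣ proj₁ z ∣

record Layered (S : List Point) (ω₁ : Point) : Set where
  field
    root-height : height ω₁ ≡ 0
    nonnegative : ∀ {z} → z ∈ S → proj₁ z ≡ + height z
    root-unique : ∀ {z} → z ∈ S → height z ≡ 0 → z ≡ ω₁
    predecessor : ∀ {z m} → z ∈ S → height z ≡ suc m → ∃ λ y → CAdj S y z × height y ≡ m

-- A predecessor of the point realized by g is realized by the next vertex of a geodesic from g
-- to the landmark r: its first distance is one less, its second changes by at most one.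
Realizable⇒Layered : ∀ {S ω₁} → Realizable S → ω₁ ∈ S → proj₁ ω₁ ≡ + 0 → Layered S ω₁
Realizable⇒Layered {S} {ω₁} (G , _ , r , _ , d₁ , d₂ , dist₁ , dist₂ , _ , onto , into) ω₁∈S ω₁₀ =
  record { root-height = cong ∣_∣ ω₁₀ ; nonnegative = nonnegative
         ; root-unique = root-unique ; predecessor = predecessor }
  where
  open SimpleGraph G using (n; Adj) renaming (sym to Adj-sym)

  image : Fin n → Point
  image g = pt (d₁ g) (d₂ g)

  nonnegative : ∀ {z} → z ∈ S → proj₁ z ≡ + height z
  nonnegative z∈S with onto _ z∈S
  ... | _ , refl = refl

  at-root : ∀ g → d₁ g ≡ 0 → g ≡ r
  at-root g d₁≡0 = length-zero⇒≡ (subst (Walk Adj g r) d₁≡0 (proj₁ (dist₁ g)))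

  root-unique : ∀ {z} → z ∈ S → height z ≡ 0 → z ≡ ω₁
  root-unique z∈S h≡0 with onto _ z∈S | onto _ ω₁∈S
  ... | g , refl | g₀ , refl = cong image (trans (at-root g h≡0) (sym (at-root g₀ (cong ∣_∣ ω₁₀))))

  predecessor-of : ∀ g {m} → d₁ g ≡ suc m → Walk Adj g r (suc m) →
                   ∃ λ y → CAdj S y (image g) × height y ≡ m
  predecessor-of g {m} d₁≡1+m (_∷_ {y = g′} e w) = image g′ , (into g′ , into g , coordinates) , d₁g′≡m
    where
    d₁g′≡m : d₁ g′ ≡ m
    d₁g′≡m = ≤-antisym (proj₂ (dist₁ g′) m w)
               (s≤s⁻¹ (subst (_≤ suc (d₁ g′)) d₁≡1+m (proj₂ (dist₁ g) _ (e ∷ proj₁ (dist₁ g′)))))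
    coordinates : ∣ + d₁ g′ - + d₁ g ∣ ⊔ ∣ + d₂ g′ - + d₂ g ∣ ≡ 1
    coordinates = adjacent-layers (trans d₁≡1+m (cong suc (sym d₁g′≡m)))
      (proj₂ (dist₂ g) _ (e ∷ proj₁ (dist₂ g′))) (proj₂ (dist₂ g′) _ (Adj-sym e ∷ proj₁ (dist₂ g)))

  predecessor : ∀ {z m} → z ∈ S → height z ≡ suc m → ∃ λ y → CAdj S y z × height y ≡ m
  predecessor z∈S h≡1+m with onto _ z∈S
  ... | g , refl = predecessor-of g h≡1+m (subst (Walk Adj g r) h≡1+m (proj₁ (dist₁ g)))

record Bypass (S : List Point) (u v t : Point) : Set where
  field
    u∈S      : u ∈ S
    height-v : height v ≡ suc (height u)
    height-t : height t ≡ height u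
    u≢t      : u ≢ t
    t–v      : CAdj S t v

Config⇒Bypass : ∀ {S u v t} → u ∈ S → proj₁ u ≡ + height u → v ∈ S → t ∈ S →
                Config u v t → Bypass S u v t
Config⇒Bypass u∈S α≥0 v∈S t∈S (case-i α β refl refl refl) = record
  { u∈S = u∈S ; height-v = ∣i+1∣≡1+∣i∣ α α≥0 ; height-t = refl
  ; u≢t = λ eq → i+[1+n]≢i β 0 (cong proj₂ eq)
  ; t–v = t∈S , v∈S , cong₂ _⊔_ (cong ∣_∣ (i-[i+1]≡-1 α)) (cong ∣_∣ (i-i≡0 β)) }
Config⇒Bypass u∈S α≥0 v∈S t∈S (case-ii α β refl refl refl) = record
  { u∈S = u∈S ; height-v = ∣i+1∣≡1+∣i∣ α α≥0 ; height-t = refl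
  ; u≢t = λ eq → i+[1+n]≢i β 0 (cong proj₂ eq)
  ; t–v = t∈S , v∈S , cong₂ _⊔_ (cong ∣_∣ (i-[i+1]≡-1 α)) (cong ∣_∣ (i-[i+1]≡-1 β)) }
Config⇒Bypass u∈S α≥0 v∈S t∈S (case-iii α β refl refl refl) = record
  { u∈S = u∈S ; height-v = ∣i+1∣≡1+∣i∣ α α≥0 ; height-t = refl
  ; u≢t = λ eq → i+[1+n]≢i β 1 (cong proj₂ eq)
  ; t–v = t∈S , v∈S , cong₂ _⊔_ (cong ∣_∣ (i-[i+1]≡-1 α)) (cong ∣_∣ (i-[i+1]≡-1 β)) }
Config⇒Bypass u∈S α≥0 v∈S t∈S (case-iv α β refl refl refl) = record
  { u∈S = u∈S ; height-v = ∣i+1∣≡1+∣i∣ α α≥0 ; height-t = refl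
  ; u≢t = λ eq → i+[1+n]≢i β 1 (sym (cong proj₂ eq))
  ; t–v = t∈S , v∈S , cong₂ _⊔_ (cong ∣_∣ (i-[i+1]≡-1 α)) (cong ∣_∣ ([i+2]-[i+1]≡1 β)) }

module Layering {S : List Point} {ω₁ : Point} (L : Layered S ω₁) where

  open Layered L

  private
    E = CAdj S

    rev : ∀ {x y k} → Walk E x y k → Walk E y x k
    rev = reverse CAdj-sym

  height-step : ∀ {x y} → E x y → height y ≤ suc (height x)
  height-step {x} {y} (x∈S , y∈S , eq) = ∣m-n∣≤1⇒n≤1+m (subst (_≤ 1) ∣x₁-y₁∣≡ ∣x₁-y₁∣≤1)
    where
    ∣x₁-y₁∣≤1 : ∣ proj₁ x - proj₁ y ∣ ≤ 1
    ∣x₁-y₁∣≤1 = subst (∣ proj₁ x - proj₁ y ∣ ≤_) eq (m≤m⊔n _ _)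
    ∣x₁-y₁∣≡ : ∣ proj₁ x - proj₁ y ∣ ≡ ℕ.∣ height x - height y ∣
    ∣x₁-y₁∣≡ = trans (cong₂ (λ i j → ∣ i - j ∣) (nonnegative x∈S) (nonnegative y∈S))
                     (∣+m-+n∣≡∣m-n∣ (height x) (height y))

  height-walk : ∀ {x y m} → Walk E x y m → height y ≤ height x ℕ.+ m
  height-walk {x} [] = ≤-reflexive (sym (+-identityʳ (height x)))
  height-walk {x} {y} (_∷_ {y = x′} {k = m} e w) = begin
    height y                   ≤⟨ height-walk w ⟩
    height x′ ℕ.+ m            ≤⟨ +-monoˡ-≤ m (height-step e) ⟩
    suc (height x) ℕ.+ m       ≡⟨ sym (+-suc (height x) m) ⟩
    height x ℕ.+ suc m         ∎
    where open ≤-Reasoning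

  -- A walk gaining j levels in j steps rises at every step, so it never returns below its start.
  rising-walk-stays-above : ∀ {z y j} (w : Walk E z y j) → height z ℕ.+ j ≤ height y →
                            All (λ z′ → height z ≤ height z′) w
  rising-walk-stays-above {z} []                    _    = [ ≤-refl ]
  rising-walk-stays-above {z} {y} (_∷_ {y = z₂} {k = j} e w) rise =
    ≤-refl ∷ All-map (≤-trans (≤-trans (n≤1+n _) (+-cancelʳ-≤ j _ _ 1+z+j≤z₂+j)))
                     (rising-walk-stays-above w z₂+j≤y)
    where
    rise′ : suc (height z) ℕ.+ j ≤ height y
    rise′ = subst (_≤ height y) (+-suc (height z) j) rise
    1+z+j≤z₂+j : suc (height z) ℕ.+ j ≤ height z₂ ℕ.+ j
    1+z+j≤z₂+j = ≤-trans rise′ (height-walk w)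
    z₂+j≤y : height z₂ ℕ.+ j ≤ height y
    z₂+j≤y = ≤-trans (+-monoˡ-≤ j (height-step e)) rise′

  descent : ∀ {z} → z ∈ S → Σ (Walk E ω₁ z (height z)) (All λ y → height y ≤ height z)
  descent z∈S = go _ z∈S refl
    where
    go : ∀ m {z} → z ∈ S → height z ≡ m → Σ (Walk E ω₁ z m) (All λ y → height y ≤ m)
    go zero    z∈S h≡0 with root-unique z∈S h≡0
    ... | refl = [] , [ ≤-reflexive h≡0 ]
    go (suc m) z∈S h≡1+m with predecessor z∈S h≡1+m
    ... | y , y–z , hy≡m with go m (proj₁ y–z) hy≡m
    ... | w , below =
      w ∷ʳ y–z , All-∷ʳ (All-map (λ h≤m → ≤-trans h≤m (n≤1+n m)) below) (≤-reflexive h≡1+m)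

  geodesic-prefix-length : ∀ {x p k i j} → Dist E ω₁ x k → p ∈ S →
                           Walk E ω₁ p i → Walk E p x j → i ℕ.+ j ≡ k → i ≡ height p
  geodesic-prefix-length {p = p} {k} {i} {j} (_ , shortest) p∈S w₁ w₂ i+j≡k = ≤-antisym i≤h h≤i
    where
    h≤i : height p ≤ i
    h≤i = subst (λ h → height p ≤ h ℕ.+ i) root-height (height-walk w₁)
    i≤h : i ≤ height p
    i≤h = +-cancelʳ-≤ j i (height p)
            (subst (_≤ _) (sym i+j≡k) (shortest _ (proj₁ (descent p∈S) ++ w₂)))

  module Bypassing {u v t : Point} (B : Bypass S u v t) where

    open Bypass B

    t∈S : t ∈ S
    t∈S = proj₁ t–v

    v∈S : v ∈ S
    v∈S = proj₁ (proj₂ t–v)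

    BelowV : Point → Set
    BelowV y = height y < height v

    below-v-avoids : ∀ {x y k} {w : Walk E x y k} → All BelowV w → Avoids u v w
    below-v-avoids below uses = <-irrefl refl (proj₂ (UsesEdge⇒All below uses))

    above-u-avoids : ∀ {x y k} {w : Walk E x y k} → All (λ y → height v ≤ height y) w → Avoids u v w
    above-u-avoids above uses = 1+n≰n (subst (_≤ height u) height-v (proj₁ (UsesEdge⇒All above uses)))

    t≢v : t ≢ v
    t≢v t≡v = 1+n≢n (trans (sym height-v) (trans (cong height (sym t≡v)) height-t))

    tv-is-not-uv : ¬ Joins u v t v
    tv-is-not-uv (inj₁ (t≡u , _)) = u≢t (sym t≡u)
    tv-is-not-uv (inj₂ (t≡v , _)) = t≢v t≡v

    vt-is-not-uv : ¬ Joins u v v t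
    vt-is-not-uv (inj₁ (_ , t≡v)) = t≢v t≡v
    vt-is-not-uv (inj₂ (_ , t≡u)) = u≢t (sym t≡u)

    ≤u⇒below-v : ∀ {y} → height y ≤ height u → BelowV y
    ≤u⇒below-v h≤hu = subst (_ <_) (sym height-v) (s≤s h≤hu)

    low-descent : ∀ {z} → z ∈ S → height z ≡ height u → Σ (Walk E ω₁ z (height z)) (All BelowV)
    low-descent {z} z∈S hz≡hu with descent z∈S
    ... | w , below = w , All-map (λ {y} h≤hz → ≤u⇒below-v {y} (≤-trans h≤hz (≤-reflexive hz≡hu))) below

    root≢u : ω₁ ≢ u
    root≢u refl = u≢t (sym (root-unique t∈S (trans height-t root-height)))

    geodesic-avoiding : ∀ {x k} → x ∈ S → Dist E ω₁ x k → (w : Walk E ω₁ x k) → UsesEdge u v w →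
                        Σ (Walk E ω₁ x k) (Avoids u v)
    geodesic-avoiding {x} {k} x∈S d w uses with UsesEdge⇒Crossing uses
    ... | crossing {i = i} {j} w₁ e w₂ (inj₁ (refl , refl)) i+1+j≡k =
      subst (λ m → Σ (Walk E ω₁ x m) (Avoids u v)) length (proj₁ to-t ++ (t–v ∷ w₂) ,
        Avoids-++ (below-v-avoids (proj₂ to-t)) (Avoids-∷ tv-is-not-uv (above-u-avoids w₂-above)))
      where
      to-t = low-descent t∈S height-t
      i≡hu : i ≡ height u
      i≡hu = geodesic-prefix-length d u∈S w₁ (e ∷ w₂) i+1+j≡k
      length : height t ℕ.+ suc j ≡ k
      length = trans (cong (ℕ._+ suc j) (trans height-t (sym i≡hu))) i+1+j≡k
      w₂-above : All (λ y → height v ≤ height y) w₂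
      w₂-above = rising-walk-stays-above w₂ (≤-reflexive (begin
        height v ℕ.+ j        ≡⟨ cong (ℕ._+ j) height-v ⟩
        suc (height u ℕ.+ j)  ≡⟨ sym (+-suc (height u) j) ⟩
        height u ℕ.+ suc j    ≡⟨ trans (cong (ℕ._+ suc j) (sym height-t)) length ⟩
        k                     ≡⟨ geodesic-prefix-length d x∈S w [] (+-identityʳ k) ⟩
        height x              ∎))
        where open ≡-Reasoning
    -- Crossing downwards, the walk would reach u both after i + 1 steps and after height u = i - 1.
    ... | crossing {i = i} {j} w₁ e w₂ (inj₂ (refl , refl)) i+1+j≡k =
      ⊥-elim (1+n≰n (≤-trans (n≤1+n _) (≤-reflexive (begin
      suc (suc (height u))  ≡⟨ cong suc (sym height-v) ⟩
      suc (height v)        ≡⟨ cong suc (sym (geodesic-prefix-length d v∈S w₁ (e ∷ w₂) i+1+j≡k)) ⟩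
      suc i                 ≡⟨ geodesic-prefix-length d u∈S (w₁ ∷ʳ e) w₂ (trans (sym (+-suc i j)) i+1+j≡k) ⟩
      height u              ∎))))
      where open ≡-Reasoning

    detour-uv : AvoidingWalk {E = E} u v u v
    detour-uv with low-descent u∈S refl | low-descent t∈S height-t
    ... | to-u , below-u | to-t , below-t =
      _ , rev to-u ++ (to-t ++ (t–v ∷ [])) ,
      Avoids-++ (below-v-avoids (All-reverse CAdj-sym below-u))
                (Avoids-++ (below-v-avoids below-t) (Avoids-∷ tv-is-not-uv λ ()))

    detour-vu : AvoidingWalk {E = E} u v v u
    detour-vu with low-descent u∈S refl | low-descent t∈S height-t
    ... | to-u , below-u | to-t , below-t =
      _ , CAdj-sym t–v ∷ (rev to-t ++ to-u) ,
      Avoids-∷ vt-is-not-uv (Avoids-++ (below-v-avoids (All-reverse CAdj-sym below-t))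
                                       (below-v-avoids below-u))

    reachable-avoiding : ∀ {a b} → a ∈ S → b ∈ S → AvoidingWalk {E = E} u v a b
    reachable-avoiding a∈S b∈S =
      reroute _≟ₚ_ detour-uv detour-vu (rev (proj₁ (descent a∈S)) ++ proj₁ (descent b∈S))

lemma10 : (S : List Point) → Realizable S →
    (ω₁ : Point) → ω₁ ∈ S → proj₁ ω₁ ≡ + 0 →
    (x u v t : Point) → x ∈ S →
    (k : ℕ) → Dist (CAdj S) ω₁ x k →
    (w : Walk (CAdj S) ω₁ x k) → UsesEdge u v w →
    Config u v t → t ∈ S →
    ¬ (ω₁ ≡ u) ×
    (Σ (Walk (CAdj S) ω₁ x k) λ w′ → ¬ UsesEdge u v w′) ×
    (∀ a b → a ∈ S → b ∈ S →
    ∃ λ m → Σ (Walk (CAdj S) a b m) λ w″ → ¬ UsesEdge u v w″)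
lemma10 S R ω₁ ω₁∈S ω₁₀ x u v t x∈S k dist w uses cfg t∈S =
  root≢u , geodesic-avoiding x∈S dist w uses , λ _ _ → reachable-avoiding
  where
  L : Layered S ω₁
  L = Realizable⇒Layered R ω₁∈S ω₁₀
  open Layering L
  uv∈S : u ∈ S × v ∈ S
  uv∈S = UsesEdge⇒All (All-∈ ω₁∈S w) uses
  open Bypassing
    (Config⇒Bypass (proj₁ uv∈S) (Layered.nonnegative L (proj₁ uv∈S)) (proj₂ uv∈S) t∈S cfg)
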